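{- In the setting described in the context, let $v\in B\setminus(B_1\cup B_2)$. Then (i) $v$ has at least one neighbor in $A\setminus C$; (ii) if $w(v)=1$, then $v$ has exactly two neighbors in $A$; (iii) if $w(v)=2$, then $v$ has exactly three incident edges.
   Context: Setting: $\mathcal{S}$ is an instance of the hereditary $3$-set packing problem, i.e., a finite family of nonempty sets of cardinality at most $3$ such that every nonempty subset of a member is a member; $w(s)=|s|-1$, $w(X)=\sum_{s\in X}w(s)$. A feasible solution is a subfamily of pairwise disjoint sets. $N(U,W)=\{x\in W:\exists u\in U:u\cap x\ne\emptyset\}$. A family $X\subseteq\mathcal{S}$ of pairwise disjoint sets is a local improvement of a feasible solution $A$ of size $|X|$ if $w(X)>w(N(X,A))$, or $w(X)=w(N(X,A))$ and $X$ contains more sets of weight $2$ than $N(X,A)$. $A$ is a feasible solution with no local improvement of size at most $10$ and $B$ is an optimum feasible solution; $A$ and $B$ consist of sets of cardinality $2$ or $3$. The conflict graph $G$ is the bipartite multigraph on $A\dot\cup B$ with exactly $|a\cap b|$ parallel edges between $a\in A$ and $b\in B$; neighbors and incident edges refer to $G$. $B_1$ is the set of $v\in B$ with exactly one neighbor in $A$; $B_2$ is the set of $v\in B$ with $w(v)=2$ having exactly two incident edges whose endpoints in $A$ are distinct. Step 1: each $v\in B_1$ sends $w(v)$ to its unique neighbor in $A$, and each $v\in B_2$ sends $1$ along each of its two edges. $C$ is the set of $u\in A$ whose total amount received in Step 1 equals exactly $w(u)$. -}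

module Defs where

open import Data.Nat using (ℕ; zero; suc; _+_; _∸_; _≤_; _<_; _≟_)
open import Data.Bool using (Bool; true; false; if_then_else_; _∧_)
open import Data.Product using (_×_; Σ; ∃; _,_)
open import Data.Sum using (_⊎_)
open import Data.Fin using (Fin)
open import Data.Fin.Subset using (Subset; _∩_; ∣_∣; Nonempty; _⊆_)
open import Data.Fin.Subset.Properties using (nonempty?)
open import Data.List using (List; []; _∷_; length; filter; map)
open import Data.Nat.ListAction using (sum)
open import Data.List.Membership.Propositional using (_∈_)
open import Data.List.Relation.Unary.All using (All)
open import Data.List.Relation.Unary.Any using (any?)
open import Data.List.Relation.Unary.AllPairs using (AllPairs)
open import Relation.Nullary using (¬_; does)
open import Relation.Binary.PropositionalEquality using (_≡_)

w : ∀ {n} → Subset n → ℕ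
w s = ∣ s ∣ ∸ 1

wFam : ∀ {n} → List (Subset n) → ℕ
wFam X = sum (map w X)

count2 : ∀ {n} → List (Subset n) → ℕ
count2 X = length (filter (λ s → w s ≟ 2) X)

Disjoint : ∀ {n} → Subset n → Subset n → Set
Disjoint s t = ¬ Nonempty (s ∩ t)

Hereditary3 : ∀ {n} → List (Subset n) → Set
Hereditary3 {n} 𝒮 =
  (∀ s → s ∈ 𝒮 → Nonempty s × ∣ s ∣ ≤ 3) ×
  (∀ s t → s ∈ 𝒮 → t ⊆ s → Nonempty t → t ∈ 𝒮)

Feasible : ∀ {n} → List (Subset n) → List (Subset n) → Set
Feasible 𝒮 X = All (_∈ 𝒮) X × AllPairs Disjoint X

N : ∀ {n} → List (Subset n) → List (Subset n) → List (Subset n)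
N U W = filter (λ x → any? (λ u → nonempty? (u ∩ x)) U) W

LocalImprovement : ∀ {n} → List (Subset n) → List (Subset n) → List (Subset n) → Set
LocalImprovement 𝒮 A X =
  Feasible 𝒮 X ×
  (wFam (N X A) < wFam X ⊎ (wFam X ≡ wFam (N X A) × count2 (N X A) < count2 X))

NoLocalImprovementUpTo : ∀ {n} → ℕ → List (Subset n) → List (Subset n) → Set
NoLocalImprovementUpTo k 𝒮 A = ∀ X → length X ≤ k → ¬ LocalImprovement 𝒮 A X

Optimum : ∀ {n} → List (Subset n) → List (Subset n) → Set
Optimum 𝒮 B = Feasible 𝒮 B × (∀ B' → Feasible 𝒮 B' → wFam B' ≤ wFam B)

Card23 : ∀ {n} → List (Subset n) → Set
Card23 X = All (λ s → ∣ s ∣ ≡ 2 ⊎ ∣ s ∣ ≡ 3) X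

-- Conflict graph G: |a ∩ b| parallel edges between a ∈ A and b ∈ B.
-- neighbours of v in A
nbrs : ∀ {n} → List (Subset n) → Subset n → List (Subset n)
nbrs A v = filter (λ a → nonempty? (a ∩ v)) A

deg : ∀ {n} → List (Subset n) → Subset n → ℕ
deg A v = sum (map (λ a → ∣ a ∩ v ∣) A)

InB1 : ∀ {n} → List (Subset n) → Subset n → Set
InB1 A v = length (nbrs A v) ≡ 1

InB2 : ∀ {n} → List (Subset n) → Subset n → Set
InB2 A v = w v ≡ 2 × deg A v ≡ 2 × length (nbrs A v) ≡ 2

isB1 : ∀ {n} → List (Subset n) → Subset n → Bool
isB1 A v = does (length (nbrs A v) ≟ 1)

isB2 : ∀ {n} → List (Subset n) → Subset n → Bool
isB2 A v = does (w v ≟ 2) ∧ (does (deg A v ≟ 2) ∧ does (length (nbrs A v) ≟ 2))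

-- Step 1: amount sent from v ∈ B to u ∈ A
-- (v ∈ B₁ sends w(v) to its unique neighbour; v ∈ B₂ sends 1 along each
--  of its edges, i.e. |u ∩ v| to u)
send : ∀ {n} → List (Subset n) → Subset n → Subset n → ℕ
send A v u =
  if isB1 A v then (if does (nonempty? (u ∩ v)) then w v else 0)
  else (if isB2 A v then ∣ u ∩ v ∣ else 0)

received : ∀ {n} → List (Subset n) → List (Subset n) → Subset n → ℕ
received A B u = sum (map (λ v → send A v u) B)

InC : ∀ {n} → List (Subset n) → List (Subset n) → Subset n → Set
InC A B u = received A B u ≡ w u

{-# OPTIONS --safe #-}
module Submission where

-- Suppose every A-neighbour u of v lay in C, i.e. received exactly w(u) in Step 1.  Delete from
-- each b ∈ B that sends something to N(v, A) the elements covered by A-sets not meeting v.  A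
-- B₁-set sending to N(v, A) has no such elements, and a B₂-set loses at most its edges to such
-- sets, so the trimmed set still has weight at least what b sent to N(v, A).  Together with v
-- these trimmed sets form a packing of at most 1 + w(N(v, A)) ≤ 7 sets that meets A only inside
-- N(v, A) and weighs at least w(v) + w(N(v, A)) > w(N(v, A)): a local improvement.  Parts (ii)
-- and (iii) are counting: by (i) and v ∉ B₁, v has at least two neighbours and at most
-- deg(v) ≤ |v| of them, and a v of weight 2 with exactly two edges would lie in B₂.

open import Defs
open import Data.Nat using (ℕ; zero; suc; _+_; _*_; _∸_; _≤_; _<_; z≤n; s≤s; _<?_; _≟_)
open import Data.Nat.Properties
open import Algebra.Properties.CommutativeSemigroup +-commutativeSemigroup
  using (interchange; x∙yz≈y∙xz; xy∙z≈x∙zy)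
open import Data.Nat.ListAction using (sum)
open import Data.Bool using (if_then_else_)
open import Data.Product using (_×_; Σ; _,_; proj₁; proj₂)
open import Data.Sum using (_⊎_; inj₁; inj₂)
open import Data.Fin.Subset using (Subset; _∩_; _─_; ⋃; ∣_∣; Nonempty; Empty; _⊆_; inside; outside)
  renaming (_∈_ to _∈ₛ_; _∉_ to _∉ₛ_)
open import Data.Fin.Subset.Properties
  using (nonempty?; Empty-unique; ∣⊥∣≡0; x∈p⇒∣p-x∣<∣p∣; p─⊥≡p; p─q─r≡p─q∪r; p─q⊆p; ⊆-refl;
         p⊆q⇒∣p∣≤∣q∣; x∈p∩q⁺; x∈p∩q⁻; x∈p∧x∉q⇒x∈p─q; p⊆p∪q; q⊆p∪q; ∩-comm)
open import Data.Vec using ([]; _∷_; there)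
open import Data.List using (List; []; _∷_; length; filter; map)
open import Data.List.Properties using (map-cong; map-cong-local; map-∘; length-map; filter-some)
open import Data.List.Membership.Propositional using (_∈_; find)
open import Data.List.Membership.Propositional.Properties using (∈-filter⁺; ∈-filter⁻; ∈-length)
open import Data.List.Relation.Unary.All as All using (All; []; _∷_)
import Data.List.Relation.Unary.All.Properties as Allₚ
open import Data.List.Relation.Unary.Any as Any using (Any; here; there)
import Data.List.Relation.Unary.Any.Properties as Anyₚ
open import Data.List.Relation.Unary.AllPairs as AllPairs using (AllPairs; []; _∷_)
import Data.List.Relation.Unary.AllPairs.Properties as AllPairsₚ
open import Function using (_∘_)
open import Relation.Nullary using (¬_; does; Dec; yes; no; ¬?; contradiction)
open import Relation.Nullary.Decidable using (dec-true; dec-false; _×-dec_)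
open import Relation.Unary using (Decidable)
open import Relation.Binary using (Symmetric)
open import Relation.Binary.PropositionalEquality
  using (_≡_; _≢_; refl; sym; trans; cong; cong₂; subst; ≢-sym; module ≡-Reasoning)

private variable
  X Y : Set
  n : ℕ
  p q p′ q′ : Subset n

m≤n∸1⇒m<n : ∀ {m} n → 0 < m → m ≤ n ∸ 1 → m < n
m≤n∸1⇒m<n zero    (s≤s _) ()
m≤n∸1⇒m<n (suc n) _       m≤n = s≤s m≤n

m+n≡1⇒m≡1×n≡0 : ∀ m n → m + n ≡ 1 → 0 < m → m ≡ 1 × n ≡ 0
m+n≡1⇒m≡1×n≡0 (suc zero) zero refl _ = refl , refl

0<k*m⇒0<m : ∀ k m → 0 < k * m → 0 < m
0<k*m⇒0<m k zero 0<k*0 = contradiction (*-zeroʳ k) (>⇒≢ 0<k*0)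
0<k*m⇒0<m k (suc m) _ = s≤s z≤n

sum-map-zero : ∀ (f : X → ℕ) {xs} → All (λ x → f x ≡ 0) xs → sum (map f xs) ≡ 0
sum-map-zero f [] = refl
sum-map-zero f (fx≡0 ∷ fxs≡0) = cong₂ _+_ fx≡0 (sum-map-zero f fxs≡0)

sum-map-mono : ∀ {f g : X → ℕ} {xs} → All (λ x → f x ≤ g x) xs → sum (map f xs) ≤ sum (map g xs)
sum-map-mono [] = z≤n
sum-map-mono (fx≤gx ∷ fxs≤gxs) = +-mono-≤ fx≤gx (sum-map-mono fxs≤gxs)

sum-map-≤-* : ∀ {f : X → ℕ} {c xs} → All (λ x → f x ≤ c) xs → sum (map f xs) ≤ length xs * c
sum-map-≤-* [] = z≤n
sum-map-≤-* (fx≤c ∷ fxs≤c) = +-mono-≤ fx≤c (sum-map-≤-* fxs≤c)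

sum-map-+ : ∀ (f g : X → ℕ) xs → sum (map (λ x → f x + g x) xs) ≡ sum (map f xs) + sum (map g xs)
sum-map-+ f g [] = refl
sum-map-+ f g (x ∷ xs) = trans (cong (f x + g x +_) (sum-map-+ f g xs)) (interchange (f x) (g x) _ _)

sum-map-comm : ∀ (f : X → Y → ℕ) xs ys →
  sum (map (λ x → sum (map (f x) ys)) xs) ≡ sum (map (λ y → sum (map (λ x → f x y) xs)) ys)
sum-map-comm f [] ys = sym (sum-map-zero (λ _ → 0) (All.universal (λ _ → refl) ys))
sum-map-comm f (x ∷ xs) ys = begin
  sum (map (f x) ys) + sum (map (λ x → sum (map (f x) ys)) xs)
    ≡⟨ cong (sum (map (f x) ys) +_) (sum-map-comm f xs ys) ⟩
  sum (map (f x) ys) + sum (map (λ y → sum (map (λ x → f x y) xs)) ys)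
    ≡⟨ sum-map-+ (f x) (λ y → sum (map (λ x → f x y) xs)) ys ⟨
  sum (map (λ y → f x y + sum (map (λ x → f x y) xs)) ys) ∎
  where open ≡-Reasoning

module _ {P : X → Set} (P? : Decidable P) where

  sum-map-filter-partition : ∀ (f : X → ℕ) xs →
    sum (map f (filter P? xs)) + sum (map f (filter (¬? ∘ P?) xs)) ≡ sum (map f xs)
  sum-map-filter-partition f [] = refl
  sum-map-filter-partition f (x ∷ xs) with P? x
  ... | yes _ = trans (+-assoc (f x) _ _) (cong (f x +_) (sum-map-filter-partition f xs))
  ... | no _  = trans (x∙yz≈y∙xz (sum (map f (filter P? xs))) (f x) _)
                      (cong (f x +_) (sum-map-filter-partition f xs))

  length-filter-partition : ∀ {Q : X → Set} (Q? : Decidable Q) xs →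
    length (filter Q? (filter P? xs)) + length (filter Q? (filter (¬? ∘ P?) xs)) ≡ length (filter Q? xs)
  length-filter-partition Q? [] = refl
  length-filter-partition Q? (x ∷ xs) with P? x
  ... | yes _ with Q? x
  ...   | yes _ = cong suc (length-filter-partition Q? xs)
  ...   | no _  = length-filter-partition Q? xs
  length-filter-partition Q? (x ∷ xs) | no _ with Q? x
  ...   | yes _ = trans (+-suc _ _) (cong suc (length-filter-partition Q? xs))
  ...   | no _  = length-filter-partition Q? xs

  sum-map-if : ∀ k xs → sum (map (λ x → if does (P? x) then k else 0) xs) ≡ k * length (filter P? xs)
  sum-map-if k [] = sym (*-zeroʳ k)
  sum-map-if k (x ∷ xs) with P? x
  ... | yes _ = trans (cong (k +_) (sum-map-if k xs)) (sym (*-suc k _))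
  ... | no _  = sum-map-if k xs

  length-filter≤sum-map : ∀ (f : X → ℕ) → (∀ {x} → P x → 0 < f x) → ∀ xs →
    length (filter P? xs) ≤ sum (map f xs)
  length-filter≤sum-map f Px⇒0<fx [] = z≤n
  length-filter≤sum-map f Px⇒0<fx (x ∷ xs) with P? x
  ... | yes Px = +-mono-≤ (Px⇒0<fx Px) (length-filter≤sum-map f Px⇒0<fx xs)
  ... | no _   = ≤-trans (length-filter≤sum-map f Px⇒0<fx xs) (m≤n+m _ (f x))

  sum-map-filter-mono : ∀ {Q : X → Set} (Q? : Decidable Q) (f : X → ℕ) xs →
    (∀ {x} → x ∈ xs → P x → Q x) → sum (map f (filter P? xs)) ≤ sum (map f (filter Q? xs))
  sum-map-filter-mono Q? f [] _ = z≤n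
  sum-map-filter-mono Q? f (x ∷ xs) P⇒Q with P? x | Q? x
  ... | yes _  | yes _  = +-monoʳ-≤ (f x) (sum-map-filter-mono Q? f xs (P⇒Q ∘ there))
  ... | yes Px | no ¬Qx = contradiction (P⇒Q (here refl) Px) ¬Qx
  ... | no _   | yes _  = ≤-trans (sum-map-filter-mono Q? f xs (P⇒Q ∘ there)) (m≤n+m _ (f x))
  ... | no _   | no _   = sum-map-filter-mono Q? f xs (P⇒Q ∘ there)

sum-map-filter-positive : ∀ (f : X → ℕ) xs → sum (map f (filter (λ x → 0 <? f x) xs)) ≡ sum (map f xs)
sum-map-filter-positive f xs = begin
  sum (map f (filter positive? xs))
    ≡⟨ +-identityʳ _ ⟨
  sum (map f (filter positive? xs)) + 0
    ≡⟨ cong (sum (map f (filter positive? xs)) +_) (sum-map-zero f zeros) ⟨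
  sum (map f (filter positive? xs)) + sum (map f (filter (¬? ∘ positive?) xs))
    ≡⟨ sum-map-filter-partition positive? f xs ⟩
  sum (map f xs) ∎
  where
  open ≡-Reasoning
  positive? = λ x → 0 <? f x
  zeros : All (λ x → f x ≡ 0) (filter (¬? ∘ positive?) xs)
  zeros = All.map (n≤0⇒n≡0 ∘ ≮⇒≥) (Allₚ.all-filter (¬? ∘ positive?) xs)

AllPairs-∈ : ∀ {R : X → X → Set} → Symmetric R → ∀ {xs} → AllPairs R xs →
  ∀ {x y} → x ∈ xs → y ∈ xs → x ≡ y ⊎ R x y
AllPairs-∈ R-sym (_ ∷ _)     (here refl) (here refl) = inj₁ refl
AllPairs-∈ R-sym (Rx ∷ _)    (here refl) (there y∈)  = inj₂ (All.lookup Rx y∈)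
AllPairs-∈ R-sym (Rx ∷ _)    (there x∈)  (here refl) = inj₂ (R-sym (All.lookup Rx x∈))
AllPairs-∈ R-sym (_ ∷ Rxs)   (there x∈)  (there y∈)  = AllPairs-∈ R-sym Rxs x∈ y∈

Nonempty⇒0<∣p∣ : Nonempty p → 0 < ∣ p ∣
Nonempty⇒0<∣p∣ (_ , x∈p) = ≤-trans (s≤s z≤n) (x∈p⇒∣p-x∣<∣p∣ x∈p)

Empty⇒∣p∣≡0 : ∀ {n} {p : Subset n} → Empty p → ∣ p ∣ ≡ 0
Empty⇒∣p∣≡0 {n = n} p-empty = trans (cong ∣_∣ (Empty-unique p-empty)) (∣⊥∣≡0 n)

0<∣p∣⇒Nonempty : 0 < ∣ p ∣ → Nonempty p
0<∣p∣⇒Nonempty {p = p} 0<∣p∣ with nonempty? p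
... | yes p-nonempty = p-nonempty
... | no p-empty     = contradiction (Empty⇒∣p∣≡0 p-empty) (>⇒≢ 0<∣p∣)

x∈p─q⇒x∉q : ∀ (p q : Subset n) {x} → x ∈ₛ p ─ q → x ∉ₛ q
x∈p─q⇒x∉q (_ ∷ p) (inside ∷ q)  (there x∈p─q) (there x∈q) = x∈p─q⇒x∉q p q x∈p─q x∈q
x∈p─q⇒x∉q (_ ∷ p) (outside ∷ q) (there x∈p─q) (there x∈q) = x∈p─q⇒x∉q p q x∈p─q x∈q

∈⇒⊆⋃ : ∀ {ps : List (Subset n)} → p ∈ ps → p ⊆ ⋃ ps
∈⇒⊆⋃ {ps = p ∷ ps} (here refl) = p⊆p∪q (⋃ ps)
∈⇒⊆⋃ {ps = q ∷ ps} (there p∈ps) x∈p = q⊆p∪q q (⋃ ps) (∈⇒⊆⋃ p∈ps x∈p)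

∣p∣≡∣p─q∣+∣q∩p∣ : ∀ (p q : Subset n) → ∣ p ∣ ≡ ∣ p ─ q ∣ + ∣ q ∩ p ∣
∣p∣≡∣p─q∣+∣q∩p∣ []            []            = refl
∣p∣≡∣p─q∣+∣q∩p∣ (inside ∷ p)  (inside ∷ q)  = trans (cong suc (∣p∣≡∣p─q∣+∣q∩p∣ p q)) (sym (+-suc _ _))
∣p∣≡∣p─q∣+∣q∩p∣ (inside ∷ p)  (outside ∷ q) = cong suc (∣p∣≡∣p─q∣+∣q∩p∣ p q)
∣p∣≡∣p─q∣+∣q∩p∣ (outside ∷ p) (inside ∷ q)  = ∣p∣≡∣p─q∣+∣q∩p∣ p q
∣p∣≡∣p─q∣+∣q∩p∣ (outside ∷ p) (outside ∷ q) = ∣p∣≡∣p─q∣+∣q∩p∣ p q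

Disjoint-sym : Symmetric (Disjoint {n})
Disjoint-sym {x = p} {q} p#q (x , x∈q∩p) =
  let x∈q , x∈p = x∈p∩q⁻ q p x∈q∩p in p#q (x , x∈p∩q⁺ (x∈p , x∈q))

Disjoint-mono : p ⊆ p′ → q ⊆ q′ → Disjoint p′ q′ → Disjoint p q
Disjoint-mono {p = p} {q = q} p⊆p′ q⊆q′ p′#q′ (x , x∈p∩q) =
  let x∈p , x∈q = x∈p∩q⁻ p q x∈p∩q in p′#q′ (x , x∈p∩q⁺ (p⊆p′ x∈p , q⊆q′ x∈q))

module _ (s : Subset n) where

  ∣s∣≡1+w : ∣ s ∣ ≡ 2 ⊎ ∣ s ∣ ≡ 3 → ∣ s ∣ ≡ suc (w s)
  ∣s∣≡1+w (inj₁ ∣s∣≡2) rewrite ∣s∣≡2 = refl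
  ∣s∣≡1+w (inj₂ ∣s∣≡3) rewrite ∣s∣≡3 = refl

  ∣s∣≤3 : ∣ s ∣ ≡ 2 ⊎ ∣ s ∣ ≡ 3 → ∣ s ∣ ≤ 3
  ∣s∣≤3 (inj₁ ∣s∣≡2) rewrite ∣s∣≡2 = s≤s (s≤s z≤n)
  ∣s∣≤3 (inj₂ ∣s∣≡3) rewrite ∣s∣≡3 = ≤-refl

  0<w : ∣ s ∣ ≡ 2 ⊎ ∣ s ∣ ≡ 3 → 0 < w s
  0<w (inj₁ ∣s∣≡2) rewrite ∣s∣≡2 = s≤s z≤n
  0<w (inj₂ ∣s∣≡3) rewrite ∣s∣≡3 = s≤s z≤n

  w≤2 : ∣ s ∣ ≡ 2 ⊎ ∣ s ∣ ≡ 3 → w s ≤ 2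
  w≤2 (inj₁ ∣s∣≡2) rewrite ∣s∣≡2 = s≤s z≤n
  w≤2 (inj₂ ∣s∣≡3) rewrite ∣s∣≡3 = ≤-refl

-- The conflict graph and Step 1

meets? : (p : Subset n) → Decidable (λ a → Nonempty (a ∩ p))
meets? p a = nonempty? (a ∩ p)

deg-mono : ∀ (L : List (Subset n)) → p ⊆ q → deg L p ≤ deg L q
deg-mono {p = p} {q = q} L p⊆q = sum-map-mono (All.universal (λ a → p⊆q⇒∣p∣≤∣q∣ (a∩p⊆a∩q a)) L)
  where
  a∩p⊆a∩q : ∀ a → a ∩ p ⊆ a ∩ q
  a∩p⊆a∩q a x∈a∩p = let x∈a , x∈p = x∈p∩q⁻ a p x∈a∩p in x∈p∩q⁺ (x∈a , p⊆q x∈p)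

deg≤deg-─ : ∀ {a} {L : List (Subset n)} → All (Disjoint a) L → deg L p ≤ deg L (p ─ a)
deg≤deg-─ {p = p} {a} a#L = sum-map-mono (All.map (λ {a′} a#a′ → p⊆q⇒∣p∣≤∣q∣ (away a#a′)) a#L)
  where
  away : ∀ {a′} → Disjoint a a′ → a′ ∩ p ⊆ a′ ∩ (p ─ a)
  away {a′} a#a′ x∈a′∩p =
    let x∈a′ , x∈p = x∈p∩q⁻ a′ p x∈a′∩p
    in x∈p∩q⁺ (x∈a′ , x∈p∧x∉q⇒x∈p─q x∈p (λ x∈a → a#a′ (_ , x∈p∩q⁺ (x∈a , x∈a′))))

deg≤∣p∣ : ∀ {L : List (Subset n)} → AllPairs Disjoint L → deg L p ≤ ∣ p ∣
deg≤∣p∣ [] = z≤n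
deg≤∣p∣ {p = p} {a ∷ L} (a#L ∷ L-disjoint) = begin
  ∣ a ∩ p ∣ + deg L p    ≤⟨ +-monoʳ-≤ ∣ a ∩ p ∣ (≤-trans (deg≤deg-─ a#L) (deg≤∣p∣ L-disjoint)) ⟩
  ∣ a ∩ p ∣ + ∣ p ─ a ∣  ≡⟨ +-comm ∣ a ∩ p ∣ _ ⟩
  ∣ p ─ a ∣ + ∣ a ∩ p ∣  ≡⟨ ∣p∣≡∣p─q∣+∣q∩p∣ p a ⟨
  ∣ p ∣                  ∎
  where open ≤-Reasoning

∣p∣≤∣p─⋃L∣+deg : ∀ (L : List (Subset n)) p → ∣ p ∣ ≤ ∣ p ─ ⋃ L ∣ + deg L p
∣p∣≤∣p─⋃L∣+deg [] p = ≤-reflexive (trans (cong ∣_∣ (sym (p─⊥≡p p))) (sym (+-identityʳ _)))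
∣p∣≤∣p─⋃L∣+deg (a ∷ L) p = begin
  ∣ p ∣                         ≡⟨ ∣p∣≡∣p─q∣+∣q∩p∣ p a ⟩
  ∣ p ─ a ∣ + e                 ≤⟨ +-monoˡ-≤ e (∣p∣≤∣p─⋃L∣+deg L (p ─ a)) ⟩
  ∣ rest ∣ + deg L (p ─ a) + e  ≤⟨ +-monoˡ-≤ e (+-monoʳ-≤ ∣ rest ∣ (deg-mono L (p─q⊆p p a))) ⟩
  ∣ rest ∣ + deg L p + e        ≡⟨ xy∙z≈x∙zy ∣ rest ∣ (deg L p) e ⟩
  ∣ rest ∣ + (e + deg L p)      ≡⟨ cong (λ r → ∣ r ∣ + deg (a ∷ L) p) (p─q─r≡p─q∪r p a (⋃ L)) ⟩
  ∣ p ─ ⋃ (a ∷ L) ∣ + deg (a ∷ L) p ∎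
  where
  open ≤-Reasoning
  e = ∣ a ∩ p ∣
  rest = p ─ a ─ ⋃ L

length-nbrs≤deg : ∀ (L : List (Subset n)) p → length (nbrs L p) ≤ deg L p
length-nbrs≤deg L p = length-filter≤sum-map (meets? p) (λ a → ∣ a ∩ p ∣) Nonempty⇒0<∣p∣ L

deg≡0 : ∀ (L : List (Subset n)) → length (nbrs L p) ≡ 0 → deg L p ≡ 0
deg≡0 {p = p} L no-nbrs = sum-map-zero (λ a → ∣ a ∩ p ∣)
  (All.map Empty⇒∣p∣≡0 (Allₚ.¬Any⇒All¬ L (λ meeting → >⇒≢ (filter-some (meets? p) meeting) no-nbrs)))

-- Stated so that does (InB2? A b) is definitionally isB2 A b.
InB2? : ∀ (A : List (Subset n)) b → Dec (InB2 A b)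
InB2? A b = w b ≟ 2 ×-dec deg A b ≟ 2 ×-dec length (nbrs A b) ≟ 2

module _ (A : List (Subset n)) {b u : Subset n} where

  send-B₁ : InB1 A b → send A b u ≡ (if does (nonempty? (u ∩ b)) then w b else 0)
  send-B₁ b∈B₁ rewrite dec-true (length (nbrs A b) ≟ 1) b∈B₁ = refl

  send-B₂ : ¬ InB1 A b → InB2 A b → send A b u ≡ ∣ u ∩ b ∣
  send-B₂ b∉B₁ b∈B₂ rewrite dec-false (length (nbrs A b) ≟ 1) b∉B₁ | dec-true (InB2? A b) b∈B₂ = refl

  send-other : ¬ InB1 A b → ¬ InB2 A b → send A b u ≡ 0
  send-other b∉B₁ b∉B₂ rewrite dec-false (length (nbrs A b) ≟ 1) b∉B₁ | dec-false (InB2? A b) b∉B₂ = refl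

-- The local improvement built from v

module Candidate (A B : List (Subset n)) (v : Subset n) where

  near far : List (Subset n)
  near = nbrs A v
  far = filter (¬? ∘ meets? v) A

  trim : Subset n → Subset n
  trim b = b ─ ⋃ far

  sent : Subset n → ℕ
  sent b = sum (map (send A b) near)

  senders : List (Subset n)
  senders = filter (λ b → 0 <? sent b) B

  candidate : List (Subset n)
  candidate = v ∷ map trim senders

  sent≡0 : ∀ {b} → ¬ InB1 A b → ¬ InB2 A b → sent b ≡ 0
  sent≡0 {b} b∉B₁ b∉B₂ = sum-map-zero (send A b) (All.universal (λ _ → send-other A b∉B₁ b∉B₂) near)

  sent+deg-far≡w-B₁ : ∀ {b} → InB1 A b → 0 < sent b → sent b + deg far b ≡ w b
  sent+deg-far≡w-B₁ {b} b∈B₁ 0<sent = begin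
    sent b + deg far b                 ≡⟨ cong₂ _+_ sent≡ (deg≡0 far far-count≡0) ⟩
    w b * length (nbrs near b) + 0     ≡⟨ +-identityʳ _ ⟩
    w b * length (nbrs near b)         ≡⟨ cong (w b *_) near-count≡1 ⟩
    w b * 1                            ≡⟨ *-identityʳ (w b) ⟩
    w b                                ∎
    where
    open ≡-Reasoning
    sent≡ : sent b ≡ w b * length (nbrs near b)
    sent≡ = trans (cong sum (map-cong (λ _ → send-B₁ A b∈B₁) near)) (sum-map-if (meets? b) (w b) near)
    counts : length (nbrs near b) ≡ 1 × length (nbrs far b) ≡ 0
    counts = m+n≡1⇒m≡1×n≡0 _ _ (trans (length-filter-partition (meets? v) (meets? b) A) b∈B₁)
                               (0<k*m⇒0<m (w b) _ (subst (0 <_) sent≡ 0<sent))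
    near-count≡1 = proj₁ counts
    far-count≡0 = proj₂ counts

  sent+deg-far≡w-B₂ : ∀ {b} → ¬ InB1 A b → InB2 A b → sent b + deg far b ≡ w b
  sent+deg-far≡w-B₂ {b} b∉B₁ b∈B₂@(w≡2 , deg≡2 , _) = begin
    sent b + deg far b      ≡⟨ cong (_+ deg far b) (cong sum (map-cong (λ _ → send-B₂ A b∉B₁ b∈B₂) near)) ⟩
    deg near b + deg far b  ≡⟨ sum-map-filter-partition (meets? v) (λ a → ∣ a ∩ b ∣) A ⟩
    deg A b                 ≡⟨ trans deg≡2 (sym w≡2) ⟩
    w b                     ∎
    where open ≡-Reasoning

  sent+deg-far≡w : ∀ {b} → 0 < sent b → sent b + deg far b ≡ w b
  sent+deg-far≡w {b} 0<sent with length (nbrs A b) ≟ 1 | InB2? A b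
  ... | yes b∈B₁ | _        = sent+deg-far≡w-B₁ b∈B₁ 0<sent
  ... | no b∉B₁  | yes b∈B₂ = sent+deg-far≡w-B₂ b∉B₁ b∈B₂
  ... | no b∉B₁  | no b∉B₂  = contradiction (sent≡0 b∉B₁ b∉B₂) (>⇒≢ 0<sent)

  sent<∣trim∣ : ∀ {b} → 0 < sent b → sent b < ∣ trim b ∣
  sent<∣trim∣ {b} 0<sent = +-cancelʳ-< (deg far b) (sent b) ∣ trim b ∣ (begin-strict
    sent b + deg far b      <⟨ m≤n∸1⇒m<n ∣ b ∣ (<-≤-trans 0<sent (m≤m+n _ _)) (≤-reflexive (sent+deg-far≡w 0<sent)) ⟩
    ∣ b ∣                   ≤⟨ ∣p∣≤∣p─⋃L∣+deg far b ⟩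
    ∣ trim b ∣ + deg far b  ∎)
    where open ≤-Reasoning

  sent≤w-trim : ∀ {b} → 0 < sent b → sent b ≤ w (trim b)
  sent≤w-trim 0<sent = ∸-monoˡ-≤ 1 (sent<∣trim∣ 0<sent)

  trim-disjoint-far : ∀ {a} b → a ∈ far → Disjoint (trim b) a
  trim-disjoint-far {a} b a∈far (x , x∈trim-b∩a) =
    let x∈trim-b , x∈a = x∈p∩q⁻ (trim b) a x∈trim-b∩a
    in x∈p─q⇒x∉q b (⋃ far) x∈trim-b (∈⇒⊆⋃ a∈far x∈a)

  meets-candidate⇒meets-v : ∀ {a} → a ∈ A → Any (λ u → Nonempty (u ∩ a)) candidate → Nonempty (a ∩ v)
  meets-candidate⇒meets-v {a} _ (here v∩a) = subst Nonempty (∩-comm v a) v∩a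
  meets-candidate⇒meets-v {a} a∈A (there meets-trimmed) with meets? v a
  ... | yes a∩v = a∩v
  ... | no ¬a∩v =
    let b , trim-b∩a = Any.satisfied (Anyₚ.map⁻ meets-trimmed)
    in contradiction trim-b∩a (trim-disjoint-far b (∈-filter⁺ (¬? ∘ meets? v) a∈A ¬a∩v))

  sum-sent≡wFam-near : All (InC A B) near → sum (map sent B) ≡ wFam near
  sum-sent≡wFam-near all-C = trans (sum-map-comm (send A) B near) (cong sum (map-cong-local all-C))

  candidate-gain : All (InC A B) near → 0 < w v → wFam (N candidate A) < wFam candidate
  candidate-gain all-C 0<w-v = begin-strict
    wFam (N candidate A)          ≤⟨ sum-map-filter-mono _ (meets? v) w A meets-candidate⇒meets-v ⟩
    wFam near                     ≡⟨ sum-sent≡wFam-near all-C ⟨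
    sum (map sent B)              ≡⟨ sum-map-filter-positive sent B ⟨
    sum (map sent senders)        ≤⟨ sum-map-mono (All.map sent≤w-trim (Allₚ.all-filter _ B)) ⟩
    sum (map (w ∘ trim) senders)  ≡⟨ cong sum (map-∘ senders) ⟩
    wFam (map trim senders)       <⟨ m<n+m _ 0<w-v ⟩
    wFam candidate                ∎
    where open ≤-Reasoning

  length-candidate≤7 : All (InC A B) near → AllPairs Disjoint A → All (λ a → w a ≤ 2) A → ∣ v ∣ ≤ 3 →
    length candidate ≤ 7
  length-candidate≤7 all-C A-disjoint A-w≤2 ∣v∣≤3 = s≤s (begin
    length (map trim senders)  ≡⟨ length-map trim senders ⟩
    length senders             ≤⟨ length-filter≤sum-map _ sent (λ 0<sent → 0<sent) B ⟩
    sum (map sent B)           ≡⟨ sum-sent≡wFam-near all-C ⟩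
    wFam near                  ≤⟨ sum-map-≤-* (Allₚ.filter⁺ (meets? v) A-w≤2) ⟩
    length near * 2            ≤⟨ *-monoˡ-≤ 2 length-near≤3 ⟩
    6                          ∎)
    where
    open ≤-Reasoning
    length-near≤3 : length near ≤ 3
    length-near≤3 = ≤-trans (length-nbrs≤deg A v) (≤-trans (deg≤∣p∣ A-disjoint) ∣v∣≤3)

  candidate-feasible : ∀ {𝒮} → Hereditary3 𝒮 → Feasible 𝒮 B → v ∈ B → sent v ≡ 0 → Feasible 𝒮 candidate
  candidate-feasible {𝒮} (_ , hereditary) (B⊆𝒮 , B-disjoint) v∈B sent-v≡0 =
      (All.lookup B⊆𝒮 v∈B ∷ Allₚ.map⁺ (All.tabulate trim∈𝒮))
    , (Allₚ.map⁺ (All.tabulate v-disjoint-trim)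
       ∷ AllPairsₚ.map⁺ (AllPairs.map (Disjoint-mono (trim⊆ _) (trim⊆ _))
                                      (AllPairsₚ.filter⁺ _ B-disjoint)))
    where
    trim⊆ : ∀ b → trim b ⊆ b
    trim⊆ b = p─q⊆p b (⋃ far)

    trim∈𝒮 : ∀ {b} → b ∈ senders → trim b ∈ 𝒮
    trim∈𝒮 {b} b∈senders =
      let b∈B , 0<sent = ∈-filter⁻ (λ b → 0 <? sent b) {xs = B} b∈senders
      in hereditary b (trim b) (All.lookup B⊆𝒮 b∈B) (trim⊆ b)
           (0<∣p∣⇒Nonempty (<-trans 0<sent (sent<∣trim∣ 0<sent)))

    v-disjoint-trim : ∀ {b} → b ∈ senders → Disjoint v (trim b)
    v-disjoint-trim {b} b∈senders with ∈-filter⁻ (λ b → 0 <? sent b) {xs = B} b∈senders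
    ... | b∈B , 0<sent with AllPairs-∈ Disjoint-sym B-disjoint v∈B b∈B
    ...   | inj₁ refl = contradiction sent-v≡0 (>⇒≢ 0<sent)
    ...   | inj₂ v#b  = Disjoint-mono ⊆-refl (trim⊆ b) v#b

some-neighbour-∉C : ∀ {𝒮 A B : List (Subset n)} {v} →
  Hereditary3 𝒮 → AllPairs Disjoint A → NoLocalImprovementUpTo 10 𝒮 A → Feasible 𝒮 B → Card23 A →
  ∣ v ∣ ≡ 2 ⊎ ∣ v ∣ ≡ 3 → v ∈ B → ¬ InB1 A v → ¬ InB2 A v →
  Any (λ a → ¬ InC A B a) (nbrs A v)
some-neighbour-∉C {A = A} {B} {v} hered A-disjoint no-improvement B-feasible A-card v-card v∈B v∉B₁ v∉B₂ =
  Allₚ.¬All⇒Any¬ (λ a → received A B a ≟ w a) (nbrs A v) all-C⇒improvement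
  where
  open Candidate A B v
  all-C⇒improvement : ¬ All (InC A B) near
  all-C⇒improvement all-C = no-improvement candidate
    (≤-trans (length-candidate≤7 all-C A-disjoint (All.map (λ {a} → w≤2 a) A-card) (∣s∣≤3 v v-card))
             (m≤m+n 7 3))
    ( candidate-feasible hered B-feasible v∈B (sent≡0 v∉B₁ v∉B₂)
    , inj₁ (candidate-gain all-C (0<w v v-card)))

proposition8 : (n : ℕ) (𝒮 A B : List (Subset n)) →
    Hereditary3 𝒮 →
    Feasible 𝒮 A → NoLocalImprovementUpTo 10 𝒮 A →
    Optimum 𝒮 B →
    Card23 A → Card23 B →
    (v : Subset n) → v ∈ B → ¬ InB1 A v → ¬ InB2 A v →
    (Σ (Subset n) (λ a → a ∈ A × Nonempty (a ∩ v) × ¬ InC A B a)) ×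
    (w v ≡ 1 → length (nbrs A v) ≡ 2) ×
    (w v ≡ 2 → deg A v ≡ 3)
proposition8 n 𝒮 A B hered A-feasible no-improvement (B-feasible , _) A-card B-card v v∈B v∉B₁ v∉B₂
  with find (some-neighbour-∉C hered (proj₂ A-feasible) no-improvement B-feasible A-card
               (All.lookup B-card v∈B) v∈B v∉B₁ v∉B₂)
... | a , a∈nbrs , a∉C =
  let a∈A , a∩v = ∈-filter⁻ (meets? v) {xs = A} a∈nbrs
  in (a , a∈A , a∩v , a∉C) , two-neighbours , three-edges
  where
  l≤deg : length (nbrs A v) ≤ deg A v
  l≤deg = length-nbrs≤deg A v
  deg≤1+w : deg A v ≤ suc (w v)
  deg≤1+w = ≤-trans (deg≤∣p∣ (proj₂ A-feasible)) (≤-reflexive (∣s∣≡1+w v (All.lookup B-card v∈B)))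
  2≤l : 2 ≤ length (nbrs A v)
  2≤l = ≤∧≢⇒< (∈-length a∈nbrs) (≢-sym v∉B₁)

  two-neighbours : w v ≡ 1 → length (nbrs A v) ≡ 2
  two-neighbours w≡1 = ≤-antisym (≤-trans l≤deg (subst (deg A v ≤_) (cong suc w≡1) deg≤1+w)) 2≤l

  three-edges : w v ≡ 2 → deg A v ≡ 3
  three-edges w≡2 =
    ≤-antisym (subst (deg A v ≤_) (cong suc w≡2) deg≤1+w) (≤∧≢⇒< (≤-trans 2≤l l≤deg) 2≢deg)
    where
    2≢deg : 2 ≢ deg A v
    2≢deg 2≡deg = v∉B₂ (w≡2 , sym 2≡deg , ≤-antisym (subst (length (nbrs A v) ≤_) (sym 2≡deg) l≤deg) 2≤l)
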